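{- For every integer $n\ge1$, the element $$\Gamma_{(2,1,\dots,1)}=\sum_{k=0}^n(-1)^k\binom{n}{k}(0,\underbrace{1,\dots,1}_{k},2,\underbrace{1,\dots,1}_{n-k})$$ is primitive in $\mathcal{C}_e$.
   Context: $\mathbb{K}$ is a field of characteristic $0$. $\mathcal{C}_e$ is the Hopf algebra with basis the extended compositions $(\alpha_0,\alpha_1,\dots,\alpha_p)$ ($\alpha_0\ge0$, $\alpha_i\ge1$ for $i\ge1$), product $(\alpha_0,\dots,\alpha_s)\ast(\beta_0,\dots,\beta_k)=(\alpha_0+\beta_0,\alpha_1,\dots,\alpha_s,\beta_1,\dots,\beta_k)$ and coproduct $\Delta((\alpha_0,\dots,\alpha_p))=\sum_{a=0}^{\alpha_0}\sum_{n=0}^{p}\sum_{1\le i_1<\dots<i_n\le p}\sum_{1\le k_{i_j}\le\alpha_{i_j}}\binom{\alpha_0}{a}\prod_j\binom{\alpha_{i_j}}{k_{i_j}}(a,k_{i_1},\dots,k_{i_n})\otimes(\alpha_0-a+\sum_j(\alpha_{i_j}-k_{i_j}),\alpha_{u_1},\dots,\alpha_{u_{p-n}})$, with $\{u_1<\dots<u_{p-n}\}$ the complement of $\{i_1,\dots,i_n\}$ in $\{1,\dots,p\}$. Primitive means $\Delta(u)=u\otimes(0)+(0)\otimes u$, $(0)$ being the unit. -}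

module Defs where

open import Level using (Level; _⊔_)
open import Data.Nat as ℕ using (ℕ; zero; suc; _∸_)
open import Data.Nat.Combinatorics using (_C_)
open import Data.Integer as ℤ using (ℤ; +_; -[1+_])
open import Data.List using (List; []; _∷_; _++_; map; concatMap; replicate; upTo; foldr)
open import Data.Product using (Σ; _×_; _,_; ∃)
import Data.Product.Properties as ×P
import Data.List.Properties as LP
open import Relation.Nullary using (¬_; yes; no)
open import Relation.Binary.Definitions using (DecidableEquality)
open import Relation.Binary.PropositionalEquality using (_≡_)
open import Algebra.Bundles using (CommutativeRing)

module _ {c ℓ} (R : CommutativeRing c ℓ) where
  open CommutativeRing R
  ιℕ : ℕ → Carrier
  ιℕ zero    = 0#
  ιℕ (suc n) = 1# + ιℕ n
  ιℤ : ℤ → Carrier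
  ιℤ (+ n)     = ιℕ n
  ιℤ -[1+ n ]  = - ιℕ (suc n)

record Char0Field (c ℓ : Level) : Set (Level.suc (c ⊔ ℓ)) where
  field
    cring : CommutativeRing c ℓ
  open CommutativeRing cring
  field
    1≉0      : ¬ (1# ≈ 0#)
    inverse  : ∀ x → ¬ (x ≈ 0#) → Σ Carrier λ y → (x * y) ≈ 1#
    char0    : ∀ n → ¬ (ιℕ cring (suc n) ≈ 0#)

-- Extended compositions (α₀ , [α₁ , … , αₚ]); the basis of 𝒞ₑ.
-- (α₀ ≥ 0, αᵢ ≥ 1 for i ≥ 1; all basis elements produced below satisfy this.)

ExtComp : Set
ExtComp = ℕ × List ℕ

ValidExtComp : ExtComp → Set
ValidExtComp (_ , αs) = Data.List.Relation.Unary.All.All (λ a → 1 ℕ.≤ a) αs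
  where import Data.List.Relation.Unary.All

_≟E_ : DecidableEquality ExtComp
_≟E_ = ×P.≡-dec ℕ._≟_ (LP.≡-dec ℕ._≟_)

unitE : ExtComp
unitE = (0 , [])

-- Elements of 𝒞ₑ (resp. 𝒞ₑ ⊗ 𝒞ₑ) with integer coefficients, written as
-- finite formal sums (lists of coefficient/basis pairs).
Elem : Set
Elem = List (ℤ × ExtComp)

Elem⊗ : Set
Elem⊗ = List (ℤ × ExtComp × ExtComp)

_∗_ : ExtComp → ExtComp → ExtComp
(a₀ , as) ∗ (b₀ , bs) = (a₀ ℕ.+ b₀ , as ++ bs)

-- choices over the parts α₁ … αₚ: each part is either not chosen (kept on the
-- right), or chosen with some 1 ≤ k ≤ αᵢ (k goes left, αᵢ - k is added to the
-- right-hand 0-th part).  Each result: (coefficient ∏ binom(αᵢ,kᵢ),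
-- left parts, extra amount for right 0-th part, right parts).
choices : List ℕ → List (ℕ × List ℕ × ℕ × List ℕ)
choices [] = (1 , [] , 0 , []) ∷ []
choices (α ∷ αs) = concatMap step (choices αs)
  where
  step : ℕ × List ℕ × ℕ × List ℕ → List (ℕ × List ℕ × ℕ × List ℕ)
  step (c , ls , e , rs) =
    (c , ls , e , α ∷ rs) ∷
    map (λ j → let k = suc j in ((α C k) ℕ.* c , k ∷ ls , (α ∸ k) ℕ.+ e , rs)) (upTo α)

Δ-basis : ExtComp → Elem⊗
Δ-basis (α₀ , αs) =
  concatMap (λ a →
    map (λ { (c , ls , e , rs) →
             (+ ((α₀ C a) ℕ.* c) , (a , ls) , ((α₀ ∸ a) ℕ.+ e , rs)) })
        (choices αs))
    (upTo (suc α₀))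

Δ : Elem → Elem⊗
Δ u = concatMap (λ { (z , b) → map (λ { (w , l , r) → (z ℤ.* w , l , r) }) (Δ-basis b) }) u

primTerm : Elem → Elem⊗
primTerm u = map (λ { (z , b) → (z , b , unitE) }) u ++ map (λ { (z , b) → (z , unitE , b) }) u

module _ {c ℓ} (K : Char0Field c ℓ) where
  open Char0Field K using (cring)
  open CommutativeRing cring

  coeff : Elem → ExtComp → Carrier
  coeff [] b = 0#
  coeff ((z , b') ∷ u) b with b' ≟E b
  ... | yes _ = ιℤ cring z + coeff u b
  ... | no  _ = coeff u b

  coeff⊗ : Elem⊗ → ExtComp → ExtComp → Carrier
  coeff⊗ [] b b' = 0#
  coeff⊗ ((z , l , r) ∷ t) b b' with l ≟E b | r ≟E b'
  ... | yes _ | yes _ = ιℤ cring z + coeff⊗ t b b'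
  ... | _     | _     = coeff⊗ t b b'

  _≈⊗_ : Elem⊗ → Elem⊗ → Set ℓ
  s ≈⊗ t = ∀ b b' → coeff⊗ s b b' ≈ coeff⊗ t b b'

  Primitive : Elem → Set ℓ
  Primitive u = Δ u ≈⊗ primTerm u

sign : ℕ → ℤ
sign zero          = + 1
sign (suc zero)    = ℤ.- (+ 1)
sign (suc (suc k)) = sign k

Γ : ℕ → Elem
Γ n = map (λ k → (sign k ℤ.* (+ (n C k)) , (0 , replicate k 1 ++ 2 ∷ replicate (n ∸ k) 1)))
          (upTo (suc n))

-- Let y = (0,1); it is primitive.  Pascal's rule for the signed binomials gives
-- Γ_(n+1) = Γ_n y − y Γ_n.  As Δ is multiplicative, Δ(u y − y u) is the commutator of Δ u
-- with y ⊗ 1 + 1 ⊗ y, and the commutator of u ⊗ 1 + 1 ⊗ u with y ⊗ 1 + 1 ⊗ y is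
-- (u y − y u) ⊗ 1 + 1 ⊗ (u y − y u): commutation with y preserves primitivity.  Γ_0 = (0,2)
-- is not primitive, Δ(0,2) = (0,2) ⊗ 1 + 1 ⊗ (0,2) + 2 y ⊗ (1), but the defect 2 y ⊗ (1)
-- commutes with y ⊗ 1 + 1 ⊗ y because (1) is central; so Γ_1 is primitive, and by
-- induction so is every Γ_n with n ≥ 1.
--
-- Tensors are compared through their pairings with integer test functions G(l, r) on pairs
-- of basis elements, so that every identity above becomes one between finite integer sums;
-- the coefficients over K are the images of the integer ones.

module Submission where

open import Defs
open import Function using (_∘_)
open import Data.Nat as ℕ using (ℕ; zero; suc; _∸_; _≥_)
import Data.Nat.Properties as ℕP
open import Data.Nat.Combinatorics using (_C_; k>n⇒nCk≡0; nCk+nC[k+1]≡[n+1]C[k+1])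
open import Data.Integer as ℤ using (ℤ; +_; -[1+_]; _⊖_)
import Data.Integer.Properties as ℤP
open import Data.Integer.Tactic.RingSolver using (solve-∀)
open import Data.Product using (_×_; _,_)
open import Data.List using (List; []; _∷_; _++_; [_]; map; concatMap; replicate; upTo)
import Data.List.Properties as LP
open import Data.List.Membership.Propositional using (_∈_)
open import Data.List.Membership.Propositional.Properties using (∈-upTo⁻)
open import Data.List.Relation.Unary.Any using (here; there)
open import Relation.Nullary using (yes; no)
open import Algebra.Bundles using (CommutativeRing)

module _ {c ℓ} (R : CommutativeRing c ℓ) where
  open CommutativeRing R
  open import Algebra.Properties.Ring ring using (-0#≈0#)
  open import Algebra.Properties.AbelianGroup +-abelianGroup using (⁻¹-∙-comm)
  open import Algebra.Properties.CommutativeSemigroup +-commutativeSemigroup using (interchange)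
  open import Relation.Binary.Reasoning.Setoid setoid

  ιℕ-+ : ∀ m n → ιℕ R (m ℕ.+ n) ≈ ιℕ R m + ιℕ R n
  ιℕ-+ zero    n = sym (+-identityˡ _)
  ιℕ-+ (suc m) n = trans (+-congˡ (ιℕ-+ m n)) (sym (+-assoc _ _ _))

  ιℤ-⊖ : ∀ m n → ιℤ R (m ⊖ n) ≈ ιℕ R m - ιℕ R n
  ιℤ-⊖ m       zero    = sym (trans (+-congˡ -0#≈0#) (+-identityʳ _))
  ιℤ-⊖ zero    (suc n) = sym (+-identityˡ _)
  ιℤ-⊖ (suc m) (suc n) rewrite ℤP.[1+m]⊖[1+n]≡m⊖n m n = begin
    ιℤ R (m ⊖ n)                    ≈⟨ ιℤ-⊖ m n ⟩
    ιℕ R m - ιℕ R n                 ≈⟨ +-identityˡ _ ⟨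
    0# + (ιℕ R m - ιℕ R n)          ≈⟨ +-congʳ (-‿inverseʳ 1#) ⟨
    (1# - 1#) + (ιℕ R m - ιℕ R n)   ≈⟨ interchange 1# (- 1#) (ιℕ R m) (- ιℕ R n) ⟩
    (1# + ιℕ R m) + (- 1# - ιℕ R n) ≈⟨ +-congˡ (⁻¹-∙-comm 1# (ιℕ R n)) ⟩
    (1# + ιℕ R m) - (1# + ιℕ R n)   ∎

  ιℤ-+ : ∀ i j → ιℤ R (i ℤ.+ j) ≈ ιℤ R i + ιℤ R j
  ιℤ-+ (+ m)    (+ n)    = ιℕ-+ m n
  ιℤ-+ (+ m)    -[1+ n ] = ιℤ-⊖ m (suc n)
  ιℤ-+ -[1+ m ] (+ n)    = trans (ιℤ-⊖ n (suc m)) (+-comm _ _)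
  ιℤ-+ -[1+ m ] -[1+ n ] = begin
    - (1# + (1# + ιℕ R (m ℕ.+ n)))      ≈⟨ -‿cong (+-congˡ (+-congˡ (ιℕ-+ m n))) ⟩
    - (1# + (1# + (ιℕ R m + ιℕ R n)))   ≈⟨ -‿cong (+-assoc _ _ _) ⟨
    - ((1# + 1#) + (ιℕ R m + ιℕ R n))   ≈⟨ -‿cong (interchange 1# 1# (ιℕ R m) (ιℕ R n)) ⟩
    - ((1# + ιℕ R m) + (1# + ιℕ R n))   ≈⟨ ⁻¹-∙-comm _ _ ⟨
    - (1# + ιℕ R m) - (1# + ιℕ R n)     ∎

-- Opened only now: in the module above, _+_, sym, trans are those of the ring.
open import Data.Integer.Base using (_+_; _*_; _-_; -_)
open import Relation.Binary.PropositionalEquality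
  using (_≡_; refl; sym; trans; cong; cong₂; module ≡-Reasoning)

private variable
  A B : Set

∑ : List A → (A → ℤ) → ℤ
∑ []       f = + 0
∑ (x ∷ xs) f = f x + ∑ xs f

∑-++ : (xs ys : List A) (f : A → ℤ) → ∑ (xs ++ ys) f ≡ ∑ xs f + ∑ ys f
∑-++ []       ys f = sym (ℤP.+-identityˡ (∑ ys f))
∑-++ (x ∷ xs) ys f = trans (cong (_+_ (f x)) (∑-++ xs ys f)) (sym (ℤP.+-assoc (f x) _ _))

∑-map : (g : A → B) (xs : List A) (f : B → ℤ) → ∑ (map g xs) f ≡ ∑ xs (f ∘ g)
∑-map g []       f = refl
∑-map g (x ∷ xs) f = cong (_+_ (f (g x))) (∑-map g xs f)

∑-concatMap : (g : A → List B) (xs : List A) (f : B → ℤ) →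
              ∑ (concatMap g xs) f ≡ ∑ xs (λ x → ∑ (g x) f)
∑-concatMap g []       f = refl
∑-concatMap g (x ∷ xs) f =
  trans (∑-++ (g x) (concatMap g xs) f) (cong (_+_ (∑ (g x) f)) (∑-concatMap g xs f))

∑-cong-∈ : (xs : List A) {f g : A → ℤ} → (∀ {x} → x ∈ xs → f x ≡ g x) → ∑ xs f ≡ ∑ xs g
∑-cong-∈ []       eq = refl
∑-cong-∈ (x ∷ xs) eq = cong₂ _+_ (eq (here refl)) (∑-cong-∈ xs (eq ∘ there))

∑-cong : (xs : List A) {f g : A → ℤ} → (∀ x → f x ≡ g x) → ∑ xs f ≡ ∑ xs g
∑-cong xs eq = ∑-cong-∈ xs (λ {x} _ → eq x)

∑-+ : (xs : List A) (f g : A → ℤ) → ∑ xs (λ x → f x + g x) ≡ ∑ xs f + ∑ xs g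
∑-+ []       f g = refl
∑-+ (x ∷ xs) f g = trans (cong (_+_ (f x + g x)) (∑-+ xs f g)) (interchange (f x) (g x) _ _)
  where
  interchange : ∀ a b c d → (a + b) + (c + d) ≡ (a + c) + (b + d)
  interchange = solve-∀

∑-- : (xs : List A) (f g : A → ℤ) → ∑ xs (λ x → f x - g x) ≡ ∑ xs f - ∑ xs g
∑-- []       f g = refl
∑-- (x ∷ xs) f g = trans (cong (_+_ (f x - g x)) (∑-- xs f g)) (interchange (f x) (g x) _ _)
  where
  interchange : ∀ a b c d → (a - b) + (c - d) ≡ (a + c) - (b + d)
  interchange = solve-∀

∑-*ˡ : (xs : List A) (k : ℤ) (f : A → ℤ) → ∑ xs (λ x → k * f x) ≡ k * ∑ xs f
∑-*ˡ []       k f = sym (ℤP.*-zeroʳ k)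
∑-*ˡ (x ∷ xs) k f =
  trans (cong (_+_ (k * f x)) (∑-*ˡ xs k f)) (sym (ℤP.*-distribˡ-+ k (f x) _))

∑-upTo-suc : ∀ m (f : ℕ → ℤ) → ∑ (upTo (suc m)) f ≡ ∑ (upTo m) f + f m
∑-upTo-suc m f = begin
  ∑ (upTo (suc m)) f          ≡⟨ cong (λ xs → ∑ xs f) (LP.upTo-∷ʳ m) ⟨
  ∑ (upTo m ++ [ m ]) f       ≡⟨ ∑-++ (upTo m) [ m ] f ⟩
  ∑ (upTo m) f + (f m + + 0)  ≡⟨ cong (_+_ (∑ (upTo m) f)) (ℤP.+-identityʳ (f m)) ⟩
  ∑ (upTo m) f + f m          ∎
  where open ≡-Reasoning

-- Summation by parts

∇ : (ℕ → ℤ) → ℕ → ℤ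
∇ a zero    = a zero
∇ a (suc k) = a (suc k) - a k

∑-∇-by-parts : ∀ m (a h : ℕ → ℤ) →
  ∑ (upTo (suc m)) (λ k → ∇ a k * h k) ≡ ∑ (upTo m) (λ k → a k * (h k - h (suc k))) + a m * h m
∑-∇-by-parts zero    a h = ℤP.+-comm (a 0 * h 0) (+ 0)
∑-∇-by-parts (suc m) a h = begin
  ∑ (upTo (suc (suc m))) (λ k → ∇ a k * h k)
    ≡⟨ ∑-upTo-suc (suc m) (λ k → ∇ a k * h k) ⟩
  ∑ (upTo (suc m)) (λ k → ∇ a k * h k) + (a (suc m) - a m) * h (suc m)
    ≡⟨ cong (_+ (a (suc m) - a m) * h (suc m)) (∑-∇-by-parts m a h) ⟩
  (S m + a m * h m) + (a (suc m) - a m) * h (suc m)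
    ≡⟨ telescope (S m) (a m) (a (suc m)) (h m) (h (suc m)) ⟩
  (S m + a m * (h m - h (suc m))) + a (suc m) * h (suc m)
    ≡⟨ cong (_+ a (suc m) * h (suc m)) (∑-upTo-suc m (λ k → a k * (h k - h (suc k)))) ⟨
  S (suc m) + a (suc m) * h (suc m) ∎
  where
  open ≡-Reasoning
  S : ℕ → ℤ
  S m = ∑ (upTo m) (λ k → a k * (h k - h (suc k)))
  telescope : ∀ s a₀ a₁ h₀ h₁ → (s + a₀ * h₀) + (a₁ - a₀) * h₁ ≡ (s + a₀ * (h₀ - h₁)) + a₁ * h₁
  telescope = solve-∀

signedBinomial : ℕ → ℕ → ℤ
signedBinomial n k = sign k * + (n C k)

sign-suc : ∀ k → sign (suc k) ≡ - sign k
sign-suc zero    = refl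
sign-suc (suc k) = sym (trans (cong -_ (sign-suc k)) (ℤP.neg-involutive (sign k)))

signedBinomial-suc : ∀ n k → signedBinomial (suc n) k ≡ ∇ (signedBinomial n) k
signedBinomial-suc n zero    = refl
signedBinomial-suc n (suc k) = begin
  sign (suc k) * + (suc n C suc k)
    ≡⟨ cong (λ c → sign (suc k) * + c) (nCk+nC[k+1]≡[n+1]C[k+1] n k) ⟨
  sign (suc k) * (+ (n C k) + + (n C suc k))
    ≡⟨ cong (λ s → s * (+ (n C k) + + (n C suc k))) (sign-suc k) ⟩
  - sign k * (+ (n C k) + + (n C suc k))
    ≡⟨ pascal (sign k) (+ (n C k)) (+ (n C suc k)) ⟩
  - sign k * + (n C suc k) - sign k * + (n C k)
    ≡⟨ cong (λ s → s * + (n C suc k) - sign k * + (n C k)) (sign-suc k) ⟨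
  sign (suc k) * + (n C suc k) - sign k * + (n C k) ∎
  where
  open ≡-Reasoning
  pascal : ∀ s b c → - s * (b + c) ≡ - s * c - s * b
  pascal = solve-∀

signedBinomial-vanishes : ∀ n → signedBinomial n (suc n) ≡ + 0
signedBinomial-vanishes n =
  trans (cong (λ c → sign (suc n) * + c) (k>n⇒nCk≡0 (ℕP.n<1+n n))) (ℤP.*-zeroʳ (sign (suc n)))

∑-signedBinomial-suc : ∀ n (h : ℕ → ℤ) →
  ∑ (upTo (suc (suc n))) (λ k → signedBinomial (suc n) k * h k)
    ≡ ∑ (upTo (suc n)) (λ k → signedBinomial n k * (h k - h (suc k)))
∑-signedBinomial-suc n h = begin
  ∑ (upTo (suc (suc n))) (λ k → signedBinomial (suc n) k * h k)
    ≡⟨ ∑-cong (upTo (suc (suc n))) (λ k → cong (_* h k) (signedBinomial-suc n k)) ⟩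
  ∑ (upTo (suc (suc n))) (λ k → ∇ (signedBinomial n) k * h k)
    ≡⟨ ∑-∇-by-parts (suc n) (signedBinomial n) h ⟩
  S + signedBinomial n (suc n) * h (suc n)
    ≡⟨ cong (λ c → S + c * h (suc n)) (signedBinomial-vanishes n) ⟩
  S + + 0
    ≡⟨ ℤP.+-identityʳ S ⟩
  S ∎
  where
  open ≡-Reasoning
  S : ℤ
  S = ∑ (upTo (suc n)) (λ k → signedBinomial n k * (h k - h (suc k)))

-- Pairing with integer test functions

⟨_∣_⟩ : Elem → (ExtComp → ℤ) → ℤ
⟨ u ∣ f ⟩ = ∑ u (λ { (z , x) → z * f x })

TestFn : Set
TestFn = ExtComp → ExtComp → ℤ

⟨_∣_⟩⊗ : Elem⊗ → TestFn → ℤ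
⟨ t ∣ G ⟩⊗ = ∑ t (λ { (w , l , r) → w * G l r })

⟨⟩-cong : ∀ u {f g : ExtComp → ℤ} → (∀ x → f x ≡ g x) → ⟨ u ∣ f ⟩ ≡ ⟨ u ∣ g ⟩
⟨⟩-cong u eq = ∑-cong u (λ { (z , x) → cong (z *_) (eq x) })

⟨⟩⊗-- : ∀ t (G H : TestFn) → ⟨ t ∣ (λ l r → G l r - H l r) ⟩⊗ ≡ ⟨ t ∣ G ⟩⊗ - ⟨ t ∣ H ⟩⊗
⟨⟩⊗-- t G H = trans (∑-cong t (λ { (w , l , r) → distrib w (G l r) (H l r) }))
                    (∑-- t (λ { (w , l , r) → w * G l r }) (λ { (w , l , r) → w * H l r }))
  where
  distrib : ∀ w a b → w * (a - b) ≡ w * a - w * b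
  distrib = solve-∀

evalΔ : TestFn → ExtComp → ℤ
evalΔ G x = ⟨ Δ-basis x ∣ G ⟩⊗

evalPrim : TestFn → ExtComp → ℤ
evalPrim G x = G x unitE + G unitE x

⟨Δ∣⟩ : ∀ u G → ⟨ Δ u ∣ G ⟩⊗ ≡ ⟨ u ∣ evalΔ G ⟩
⟨Δ∣⟩ u G = trans (∑-concatMap _ u _) (∑-cong u (λ { (z , x) → scale z x }))
  where
  scale : ∀ z x → ⟨ map (λ { (w , l , r) → (z * w , l , r) }) (Δ-basis x) ∣ G ⟩⊗ ≡ z * evalΔ G x
  scale z x =
    trans (∑-map _ (Δ-basis x) _)
      (trans (∑-cong (Δ-basis x) (λ { (w , l , r) → ℤP.*-assoc z w (G l r) }))
             (∑-*ˡ (Δ-basis x) z _))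

⟨primTerm∣⟩ : ∀ u G → ⟨ primTerm u ∣ G ⟩⊗ ≡ ⟨ u ∣ evalPrim G ⟩
⟨primTerm∣⟩ u G =
  trans (∑-++ (map _ u) (map _ u) _)
    (trans (cong₂ _+_ (∑-map _ u _) (∑-map _ u _))
      (trans (sym (∑-+ u _ _))
             (∑-cong u (λ { (z , x) → sym (ℤP.*-distribˡ-+ z (G x unitE) (G unitE x)) }))))

Choice ChoiceFn : Set
Choice   = ℕ × List ℕ × ℕ × List ℕ
ChoiceFn = List ℕ → ℕ → List ℕ → ℤ

⟨_∣_⟩ᶜ : List Choice → ChoiceFn → ℤ
⟨ cs ∣ ψ ⟩ᶜ = ∑ cs (λ { (c , ls , e , rs) → + c * ψ ls e rs })

⟨⟩ᶜ-cong : ∀ cs {ψ ψ′ : ChoiceFn} →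
           (∀ ls e rs → ψ ls e rs ≡ ψ′ ls e rs) → ⟨ cs ∣ ψ ⟩ᶜ ≡ ⟨ cs ∣ ψ′ ⟩ᶜ
⟨⟩ᶜ-cong cs eq = ∑-cong cs (λ { (c , ls , e , rs) → cong (+ c *_) (eq ls e rs) })

pos-*-assoc : ∀ m c v → + (m ℕ.* c) * v ≡ + m * (+ c * v)
pos-*-assoc m c v = trans (cong (_* v) (ℤP.pos-* m c)) (ℤP.*-assoc (+ m) (+ c) v)

onChoices : TestFn → ℕ → ℕ → ChoiceFn
onChoices G α₀ a ls e rs = G (a , ls) ((α₀ ∸ a) ℕ.+ e , rs)

evalΔ-expand : ∀ α₀ αs G →
  evalΔ G (α₀ , αs) ≡ ∑ (upTo (suc α₀)) (λ a → + (α₀ C a) * ⟨ choices αs ∣ onChoices G α₀ a ⟩ᶜ)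
evalΔ-expand α₀ αs G =
  trans (∑-concatMap (λ a → map (split a) (choices αs)) (upTo (suc α₀)) _)
    (∑-cong (upTo (suc α₀)) (λ a →
      trans (∑-map _ (choices αs) _)
        (trans (∑-cong (choices αs) (λ { (c , ls , e , rs) → pos-*-assoc (α₀ C a) c _ }))
               (∑-*ˡ (choices αs) (+ (α₀ C a)) _))))
  where
  split : ℕ → Choice → ℤ × ExtComp × ExtComp
  split a (c , ls , e , rs) = (+ ((α₀ C a) ℕ.* c) , (a , ls) , ((α₀ ∸ a) ℕ.+ e , rs))

choose : ℕ → ChoiceFn → ChoiceFn
choose α ψ ls e rs =
  ψ ls e (α ∷ rs) + ∑ (upTo α) (λ j → + (α C suc j) * ψ (suc j ∷ ls) ((α ∸ suc j) ℕ.+ e) rs)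

choices-∷ : ∀ α αs ψ → ⟨ choices (α ∷ αs) ∣ ψ ⟩ᶜ ≡ ⟨ choices αs ∣ choose α ψ ⟩ᶜ
choices-∷ α αs ψ = trans (∑-concatMap _ (choices αs) _) (∑-cong (choices αs) λ { (c , ls , e , rs) →
  trans (cong (_+_ (+ c * ψ ls e (α ∷ rs)))
          (trans (∑-map _ (upTo α) _)
            (trans (∑-cong (upTo α) (λ j →
                      trans (pos-*-assoc (α C suc j) c _) (left-comm (+ (α C suc j)) (+ c) _)))
                   (∑-*ˡ (upTo α) (+ c) _))))
        (sym (ℤP.*-distribˡ-+ (+ c) _ _)) })
  where
  left-comm : ∀ a b v → a * (b * v) ≡ b * (a * v)
  left-comm = solve-∀

choices-1∷ : ∀ αs ψ →
  ⟨ choices (1 ∷ αs) ∣ ψ ⟩ᶜ ≡ ⟨ choices αs ∣ (λ ls e rs → ψ (1 ∷ ls) e rs + ψ ls e (1 ∷ rs)) ⟩ᶜ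
choices-1∷ αs ψ = trans (choices-∷ 1 αs ψ)
  (⟨⟩ᶜ-cong (choices αs) λ ls e rs → swap (ψ ls e (1 ∷ rs)) (ψ (1 ∷ ls) e rs))
  where
  swap : ∀ a b → a + (+ 1 * b + + 0) ≡ b + a
  swap = solve-∀

choices-∷ʳ1 : ∀ αs ψ →
  ⟨ choices (αs ++ [ 1 ]) ∣ ψ ⟩ᶜ
    ≡ ⟨ choices αs ∣ (λ ls e rs → ψ (ls ++ [ 1 ]) e rs + ψ ls e (rs ++ [ 1 ])) ⟩ᶜ
choices-∷ʳ1 []       ψ = base (ψ [] 0 [ 1 ]) (ψ [ 1 ] 0 [])
  where
  base : ∀ a b → + 1 * a + (+ 1 * b + + 0) ≡ + 1 * (b + a) + + 0
  base = solve-∀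
choices-∷ʳ1 (α ∷ αs) ψ = begin
  ⟨ choices (α ∷ αs ++ [ 1 ]) ∣ ψ ⟩ᶜ        ≡⟨ choices-∷ α (αs ++ [ 1 ]) ψ ⟩
  ⟨ choices (αs ++ [ 1 ]) ∣ choose α ψ ⟩ᶜ   ≡⟨ choices-∷ʳ1 αs (choose α ψ) ⟩
  ⟨ choices αs ∣ snoc (choose α ψ) ⟩ᶜ       ≡⟨ ⟨⟩ᶜ-cong (choices αs) choose-snoc ⟩
  ⟨ choices αs ∣ choose α (snoc ψ) ⟩ᶜ       ≡⟨ choices-∷ α αs (snoc ψ) ⟨
  ⟨ choices (α ∷ αs) ∣ snoc ψ ⟩ᶜ            ∎
  where
  open ≡-Reasoning
  snoc : ChoiceFn → ChoiceFn
  snoc φ ls e rs = φ (ls ++ [ 1 ]) e rs + φ ls e (rs ++ [ 1 ])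
  interchange : ∀ a b c d → (a + b) + (c + d) ≡ (a + c) + (b + d)
  interchange = solve-∀
  choose-snoc : ∀ ls e rs → snoc (choose α ψ) ls e rs ≡ choose α (snoc ψ) ls e rs
  choose-snoc ls e rs =
    trans (interchange (ψ (ls ++ [ 1 ]) e (α ∷ rs)) (∑ (upTo α) L)
                       (ψ ls e (α ∷ rs ++ [ 1 ])) (∑ (upTo α) R))
          (cong (_+_ (ψ (ls ++ [ 1 ]) e (α ∷ rs) + ψ ls e (α ∷ rs ++ [ 1 ])))
                (sym (trans (∑-cong (upTo α) (λ j → ℤP.*-distribˡ-+ (+ (α C suc j)) _ _))
                            (∑-+ (upTo α) L R))))
    where
    L R : ℕ → ℤ
    L j = + (α C suc j) * ψ (suc j ∷ ls ++ [ 1 ]) ((α ∸ suc j) ℕ.+ e) rs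
    R j = + (α C suc j) * ψ (suc j ∷ ls) ((α ∸ suc j) ℕ.+ e) (rs ++ [ 1 ])

y₁ : ExtComp
y₁ = (0 , [ 1 ])

-- Transposes of t ↦ t (y₁ ⊗ 1 + 1 ⊗ y₁), t ↦ (y₁ ⊗ 1 + 1 ⊗ y₁) t and of their difference.
mulʳ-y₁† mulˡ-y₁† ad†y₁ : TestFn → TestFn
mulʳ-y₁† G l r = G (l ∗ y₁) r + G l (r ∗ y₁)
mulˡ-y₁† G l r = G (y₁ ∗ l) r + G l (y₁ ∗ r)
ad†y₁    G l r = mulʳ-y₁† G l r - mulˡ-y₁† G l r

evalΔ-∗y₁ : ∀ x G → evalΔ G (x ∗ y₁) ≡ evalΔ (mulʳ-y₁† G) x
evalΔ-∗y₁ (α₀ , αs) G = begin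
  evalΔ G (α₀ ℕ.+ 0 , αs ++ [ 1 ])
    ≡⟨ cong (λ a → evalΔ G (a , αs ++ [ 1 ])) (ℕP.+-identityʳ α₀) ⟩
  evalΔ G (α₀ , αs ++ [ 1 ])
    ≡⟨ evalΔ-expand α₀ (αs ++ [ 1 ]) G ⟩
  ∑ (upTo (suc α₀)) (λ a → + (α₀ C a) * ⟨ choices (αs ++ [ 1 ]) ∣ onChoices G α₀ a ⟩ᶜ)
    ≡⟨ ∑-cong (upTo (suc α₀)) (λ a → cong (+ (α₀ C a) *_)
         (trans (choices-∷ʳ1 αs (onChoices G α₀ a)) (⟨⟩ᶜ-cong (choices αs) (drop+0 a)))) ⟩
  ∑ (upTo (suc α₀)) (λ a → + (α₀ C a) * ⟨ choices αs ∣ onChoices (mulʳ-y₁† G) α₀ a ⟩ᶜ)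
    ≡⟨ evalΔ-expand α₀ αs (mulʳ-y₁† G) ⟨
  evalΔ (mulʳ-y₁† G) (α₀ , αs) ∎
  where
  open ≡-Reasoning
  drop+0 : ∀ a ls e rs → G (a , ls ++ [ 1 ]) ((α₀ ∸ a) ℕ.+ e , rs) + G (a , ls) ((α₀ ∸ a) ℕ.+ e , rs ++ [ 1 ])
                         ≡ onChoices (mulʳ-y₁† G) α₀ a ls e rs
  drop+0 a ls e rs = sym (cong₂ _+_
    (cong (λ k → G (k , ls ++ [ 1 ]) ((α₀ ∸ a) ℕ.+ e , rs)) (ℕP.+-identityʳ a))
    (cong (λ k → G (a , ls) (k , rs ++ [ 1 ])) (ℕP.+-identityʳ ((α₀ ∸ a) ℕ.+ e))))

evalΔ-y₁∗ : ∀ x G → evalΔ G (y₁ ∗ x) ≡ evalΔ (mulˡ-y₁† G) x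
evalΔ-y₁∗ (α₀ , αs) G =
  trans (evalΔ-expand α₀ (1 ∷ αs) G)
    (trans (∑-cong (upTo (suc α₀)) (λ a → cong (+ (α₀ C a) *_) (choices-1∷ αs (onChoices G α₀ a))))
           (sym (evalΔ-expand α₀ αs (mulˡ-y₁† G))))

evalΔ-ad†y₁ : ∀ x G → evalΔ (ad†y₁ G) x ≡ evalΔ G (x ∗ y₁) - evalΔ G (y₁ ∗ x)
evalΔ-ad†y₁ x G =
  trans (⟨⟩⊗-- (Δ-basis x) (mulʳ-y₁† G) (mulˡ-y₁† G))
        (sym (cong₂ _-_ (evalΔ-∗y₁ x G) (evalΔ-y₁∗ x G)))

evalPrim-ad†y₁ : ∀ x G → evalPrim (ad†y₁ G) x ≡ evalPrim G (x ∗ y₁) - evalPrim G (y₁ ∗ x)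
evalPrim-ad†y₁ x G =
  regroup (G (x ∗ y₁) unitE) (G (y₁ ∗ x) unitE) (G x y₁) (G y₁ x) (G unitE (x ∗ y₁)) (G unitE (y₁ ∗ x))
  where
  regroup : ∀ a b c d e f → ((a + c) - (b + c)) + ((d + e) - (d + f)) ≡ (a + e) - (b + f)
  regroup = solve-∀

evalΔ-02 : ∀ G → evalΔ G (0 , [ 2 ]) ≡ evalPrim G (0 , [ 2 ]) + + 2 * G y₁ (1 , [])
evalΔ-02 G = regroup (G unitE (0 , [ 2 ])) (G y₁ (1 , [])) (G (0 , [ 2 ]) unitE)
  where
  regroup : ∀ a b c → + 1 * a + (+ 2 * b + (+ 1 * c + + 0)) ≡ (c + a) + + 2 * b
  regroup = solve-∀

-- (1) is central and y₁ commutes with itself.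
ad†y₁-vanishes : ∀ G → ad†y₁ G y₁ (1 , []) ≡ + 0
ad†y₁-vanishes G = ℤP.+-inverseʳ (mulʳ-y₁† G y₁ (1 , []))

-- The recursion Γ_(n+1) = Γ_n y₁ − y₁ Γ_n

Γ-term : ℕ → ℕ → ExtComp
Γ-term n k = (0 , replicate k 1 ++ 2 ∷ replicate (n ∸ k) 1)

⟨Γ∣⟩ : ∀ n f → ⟨ Γ n ∣ f ⟩ ≡ ∑ (upTo (suc n)) (λ k → signedBinomial n k * f (Γ-term n k))
⟨Γ∣⟩ n f = ∑-map (λ k → (signedBinomial n k , Γ-term n k)) (upTo (suc n)) (λ { (z , x) → z * f x })

replicate-∷ʳ : ∀ m (x : ℕ) → replicate m x ++ [ x ] ≡ replicate (suc m) x
replicate-∷ʳ zero    x = refl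
replicate-∷ʳ (suc m) x = cong (x ∷_) (replicate-∷ʳ m x)

⟨Γ₀∣⟩ : ∀ f → ⟨ Γ 0 ∣ f ⟩ ≡ f (0 , [ 2 ])
⟨Γ₀∣⟩ f = trans (ℤP.+-identityʳ (+ 1 * f (0 , [ 2 ]))) (ℤP.*-identityˡ (f (0 , [ 2 ])))

Γ-term-∗y₁ : ∀ {n k} → k ℕ.< suc n → Γ-term n k ∗ y₁ ≡ Γ-term (suc n) k
Γ-term-∗y₁ {n} {k} (ℕ.s≤s k≤n) = cong (0 ,_) (begin
  (replicate k 1 ++ 2 ∷ replicate (n ∸ k) 1) ++ [ 1 ]
    ≡⟨ LP.++-assoc (replicate k 1) (2 ∷ replicate (n ∸ k) 1) [ 1 ] ⟩
  replicate k 1 ++ 2 ∷ replicate (n ∸ k) 1 ++ [ 1 ]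
    ≡⟨ cong (λ l → replicate k 1 ++ 2 ∷ l) (replicate-∷ʳ (n ∸ k) 1) ⟩
  replicate k 1 ++ 2 ∷ replicate (suc (n ∸ k)) 1
    ≡⟨ cong (λ m → replicate k 1 ++ 2 ∷ replicate m 1) (ℕP.+-∸-assoc 1 k≤n) ⟨
  replicate k 1 ++ 2 ∷ replicate (suc n ∸ k) 1 ∎)
  where open ≡-Reasoning

Γ-suc : ∀ n f → ⟨ Γ (suc n) ∣ f ⟩ ≡ ⟨ Γ n ∣ (λ x → f (x ∗ y₁) - f (y₁ ∗ x)) ⟩
Γ-suc n f = begin
  ⟨ Γ (suc n) ∣ f ⟩
    ≡⟨ ⟨Γ∣⟩ (suc n) f ⟩
  ∑ (upTo (suc (suc n))) (λ k → signedBinomial (suc n) k * f (Γ-term (suc n) k))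
    ≡⟨ ∑-signedBinomial-suc n (f ∘ Γ-term (suc n)) ⟩
  ∑ (upTo (suc n)) (λ k → signedBinomial n k * (f (Γ-term (suc n) k) - f (Γ-term (suc n) (suc k))))
    ≡⟨ ∑-cong-∈ (upTo (suc n)) (λ {k} k∈ →
         cong (λ x → signedBinomial n k * (f x - f (y₁ ∗ Γ-term n k))) (sym (Γ-term-∗y₁ (∈-upTo⁻ k∈)))) ⟩
  ∑ (upTo (suc n)) (λ k → signedBinomial n k * (f (Γ-term n k ∗ y₁) - f (y₁ ∗ Γ-term n k)))
    ≡⟨ ⟨Γ∣⟩ n (λ x → f (x ∗ y₁) - f (y₁ ∗ x)) ⟨
  ⟨ Γ n ∣ (λ x → f (x ∗ y₁) - f (y₁ ∗ x)) ⟩ ∎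
  where open ≡-Reasoning

Γ-suc-evalΔ≡evalPrim : ∀ n G → ⟨ Γ (suc n) ∣ evalΔ G ⟩ ≡ ⟨ Γ (suc n) ∣ evalPrim G ⟩
Γ-suc-evalΔ≡evalPrim n G = begin
  ⟨ Γ (suc n) ∣ evalΔ G ⟩
    ≡⟨ Γ-suc n (evalΔ G) ⟩
  ⟨ Γ n ∣ (λ x → evalΔ G (x ∗ y₁) - evalΔ G (y₁ ∗ x)) ⟩
    ≡⟨ ⟨⟩-cong (Γ n) (λ x → evalΔ-ad†y₁ x G) ⟨
  ⟨ Γ n ∣ evalΔ (ad†y₁ G) ⟩
    ≡⟨ induction n ⟩
  ⟨ Γ n ∣ evalPrim (ad†y₁ G) ⟩
    ≡⟨ ⟨⟩-cong (Γ n) (λ x → evalPrim-ad†y₁ x G) ⟩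
  ⟨ Γ n ∣ (λ x → evalPrim G (x ∗ y₁) - evalPrim G (y₁ ∗ x)) ⟩
    ≡⟨ Γ-suc n (evalPrim G) ⟨
  ⟨ Γ (suc n) ∣ evalPrim G ⟩ ∎
  where
  open ≡-Reasoning
  induction : ∀ m → ⟨ Γ m ∣ evalΔ (ad†y₁ G) ⟩ ≡ ⟨ Γ m ∣ evalPrim (ad†y₁ G) ⟩
  induction zero    = begin
    ⟨ Γ 0 ∣ evalΔ (ad†y₁ G) ⟩
      ≡⟨ ⟨Γ₀∣⟩ (evalΔ (ad†y₁ G)) ⟩
    evalΔ (ad†y₁ G) (0 , [ 2 ])
      ≡⟨ evalΔ-02 (ad†y₁ G) ⟩
    evalPrim (ad†y₁ G) (0 , [ 2 ]) + + 2 * ad†y₁ G y₁ (1 , [])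
      ≡⟨ cong (λ v → evalPrim (ad†y₁ G) (0 , [ 2 ]) + + 2 * v) (ad†y₁-vanishes G) ⟩
    evalPrim (ad†y₁ G) (0 , [ 2 ]) + + 0
      ≡⟨ ℤP.+-identityʳ _ ⟩
    evalPrim (ad†y₁ G) (0 , [ 2 ])
      ≡⟨ ⟨Γ₀∣⟩ (evalPrim (ad†y₁ G)) ⟨
    ⟨ Γ 0 ∣ evalPrim (ad†y₁ G) ⟩ ∎
  induction (suc m) = Γ-suc-evalΔ≡evalPrim m (ad†y₁ G)

Primitiveℤ : Elem → Set
Primitiveℤ u = ∀ G → ⟨ Δ u ∣ G ⟩⊗ ≡ ⟨ primTerm u ∣ G ⟩⊗

Γ-suc-primitiveℤ : ∀ n → Primitiveℤ (Γ (suc n))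
Γ-suc-primitiveℤ n G =
  trans (⟨Δ∣⟩ (Γ (suc n)) G) (trans (Γ-suc-evalΔ≡evalPrim n G) (sym (⟨primTerm∣⟩ (Γ (suc n)) G)))

z*0+s≡s : ∀ z s → z * + 0 + s ≡ s
z*0+s≡s z s = trans (cong (_+ s) (ℤP.*-zeroʳ z)) (ℤP.+-identityˡ s)

δ⊗ : ExtComp → ExtComp → TestFn
δ⊗ b b′ l r with l ≟E b | r ≟E b′
... | yes _ | yes _ = + 1
... | _     | _     = + 0

module _ {c ℓ} (K : Char0Field c ℓ) where
  open Char0Field K using (cring)
  open CommutativeRing cring using (_≈_; +-congˡ; setoid)
  module ≈ = CommutativeRing cring
  open import Relation.Binary.Reasoning.Setoid setoid

  coeff⊗≈ιℤ⟨δ⊗⟩ : ∀ t b b′ → coeff⊗ K t b b′ ≈ ιℤ cring ⟨ t ∣ δ⊗ b b′ ⟩⊗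
  coeff⊗≈ιℤ⟨δ⊗⟩ []                b b′ = ≈.refl
  coeff⊗≈ιℤ⟨δ⊗⟩ ((z , l , r) ∷ t) b b′ with l ≟E b | r ≟E b′
  ... | yes _ | yes _ = begin
    ιℤ cring z ≈.+ coeff⊗ K t b b′           ≈⟨ +-congˡ (coeff⊗≈ιℤ⟨δ⊗⟩ t b b′) ⟩
    ιℤ cring z ≈.+ ιℤ cring ⟨ t ∣ δ⊗ b b′ ⟩⊗ ≈⟨ ιℤ-+ cring z ⟨ t ∣ δ⊗ b b′ ⟩⊗ ⟨
    ιℤ cring (z + ⟨ t ∣ δ⊗ b b′ ⟩⊗)          ≡⟨ cong (λ w → ιℤ cring (w + _)) (ℤP.*-identityʳ z) ⟨
    ιℤ cring (z * + 1 + ⟨ t ∣ δ⊗ b b′ ⟩⊗)    ∎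
  ... | yes _ | no _  = ≈.trans (coeff⊗≈ιℤ⟨δ⊗⟩ t b b′) (≈.reflexive (cong (ιℤ cring) (sym (z*0+s≡s z _))))
  ... | no _  | _     = ≈.trans (coeff⊗≈ιℤ⟨δ⊗⟩ t b b′) (≈.reflexive (cong (ιℤ cring) (sym (z*0+s≡s z _))))

  primitiveℤ⇒Primitive : ∀ u → Primitiveℤ u → Primitive K u
  primitiveℤ⇒Primitive u prim b b′ = begin
    coeff⊗ K (Δ u) b b′                ≈⟨ coeff⊗≈ιℤ⟨δ⊗⟩ (Δ u) b b′ ⟩
    ιℤ cring ⟨ Δ u ∣ δ⊗ b b′ ⟩⊗        ≡⟨ cong (ιℤ cring) (prim (δ⊗ b b′)) ⟩
    ιℤ cring ⟨ primTerm u ∣ δ⊗ b b′ ⟩⊗ ≈⟨ coeff⊗≈ιℤ⟨δ⊗⟩ (primTerm u) b b′ ⟨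
    coeff⊗ K (primTerm u) b b′         ∎

mainTheorem18 : ∀ {c ℓ} (K : Char0Field c ℓ) (n : ℕ) → n ≥ 1 → Primitive K (Γ n)
mainTheorem18 K zero    ()
mainTheorem18 K (suc n) _ = primitiveℤ⇒Primitive K (Γ (suc n)) (Γ-suc-primitiveℤ n)
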